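{- Let $n\ge 2$. For every integer $i\ge 0$ with $i>(n-4)(n-1)$ and every $1\le k\le n$, \[ |\mathcal{L}_i\cap\mathcal{B}_k| = b_{r_i+k-n-1} \quad\text{and}\quad |\mathcal{L}_i| = c_{r_i-1}. \]
   Context: Let $n\ge 2$ be an integer. A partition is a sequence $\Lambda=(\lambda_t)_{t\ge 1}$ of non-negative integers with finite support; $\mathrm{wt}(\Lambda)=\sum_t t\lambda_t$; $x^\Lambda=\prod_t x_t^{\lambda_t}$ (monomial in commuting indeterminates), $\deg(x^\Lambda)=\sum_t\lambda_t$. $\mathrm{Part}(j)$ is the set of partitions with $\lambda_t=0$ for $t>j$; $\partial_k$ is the partial derivative with respect to $x_k$. Let $\mathcal{B}=\{x^\Lambda\partial_k:1\le k\le n,\ \Lambda\in\mathrm{Part}(k-1)\}$ and $\mathcal{B}_u=\{x^\Lambda\partial_k\in\mathcal{B}: k=u\}$. For an integer $i\ge -1$ let $r_i\in\{1,\dots,n-1\}$ with $i\equiv r_i\pmod{n-1}$ and $h_i=\lfloor (i-1)/(n-1)\rfloor+1$, so $i=(h_i-1)(n-1)+r_i$. For $x^\Lambda\partial_k\in\mathcal{B}$ define the weight-degree $\mathrm{WD}(x^\Lambda\partial_k)=\mathrm{wt}(\Lambda)-\deg(x^\Lambda)+n-k$ and the $i$-th level $\mathrm{lev}_i(x^\Lambda\partial_k)=h_i\,\mathrm{WD}(x^\Lambda\partial_k)+\deg(x^\Lambda)-1$. For $i\ge -1$ let $\mathcal{N}_i=\{b\in\mathcal{B}: \mathrm{lev}_j(b)\le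 j \text{ for some integer } j \text{ with } -1\le j\le i\}$, and for $i\ge 0$ let $\mathcal{L}_i=\mathcal{N}_i\setminus\mathcal{N}_{i-1}$. Let $a_m$ be the number of partitions of the integer $m$ ($a_0=1$), $b_m=\sum_{s=0}^m a_s$, $c_m=\sum_{s=0}^m b_s$ for $m\ge 0$, with the convention $b_m=0$ for $m<0$. -}

module Defs where

open import Data.Nat as ℕ using (ℕ; zero; suc)
open import Data.Integer as ℤ using (ℤ; +_; _-_; _/ℕ_)
open import Data.Fin using (Fin; toℕ)
open import Data.Vec using (Vec; []; _∷_)
open import Data.List using (List; []; _∷_; length; concatMap; filter; upTo)
open import Data.List.Membership.Propositional using (_∈_)
open import Data.List.Relation.Unary.Unique.Propositional using (Unique)
open import Data.Product using (Σ; Σ-syntax; ∃; ∃-syntax; _×_; _,_)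
open import Relation.Binary.PropositionalEquality using (_≡_)
open import Function.Bundles using (_⇔_)
open import Relation.Nullary using (¬_)

-- Partitions in Part(j): a vector (λ_1, …, λ_j) of naturals
-- (λ_t = 0 for t > j is implicit).

Part : ℕ → Set
Part j = Vec ℕ j

wtFrom : ∀ {j} → ℕ → Vec ℕ j → ℕ
wtFrom s []       = 0
wtFrom s (l ∷ ls) = s ℕ.* l ℕ.+ wtFrom (suc s) ls

wt : ∀ {j} → Part j → ℕ
wt = wtFrom 1

deg : ∀ {j} → Part j → ℕ
deg []       = 0
deg (l ∷ ls) = l ℕ.+ deg ls

-- The basis ℬ: an element x^Λ ∂_k with 1 ≤ k ≤ n and Λ ∈ Part(k-1)
-- is represented by (k' , Λ) with k' : Fin n, k = toℕ k' + 1,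
-- and Λ ∈ Part(toℕ k') = Part(k-1).

Basis : ℕ → Set
Basis n = Σ[ k' ∈ Fin n ] Part (toℕ k')

kOf : ∀ {n} → Basis n → ℕ
kOf (k' , _) = suc (toℕ k')

degB : ∀ {n} → Basis n → ℕ
degB (_ , Λ) = deg Λ

wtB : ∀ {n} → Basis n → ℕ
wtB (_ , Λ) = wt Λ

WD : (n : ℕ) → Basis n → ℤ
WD n b = ((+ wtB b) - (+ degB b)) ℤ.+ (+ n) - (+ kOf b)

-- h_i = ⌊(i-1)/(n-1)⌋ + 1 and r_i = i - (h_i - 1)(n-1) ∈ {1,…,n-1}.
-- (Only meaningful for n ≥ 2; junk value 0 otherwise.)

hh : ℕ → ℤ → ℤ
hh (suc (suc m)) i = ((i - ℤ.1ℤ) /ℕ suc m) ℤ.+ ℤ.1ℤ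
hh _             i = ℤ.0ℤ

rr : ℕ → ℤ → ℤ
rr n i = i - (hh n i - ℤ.1ℤ) ℤ.* (+ (n ℕ.∸ 1))

lev : (n : ℕ) → ℤ → Basis n → ℤ
lev n i b = hh n i ℤ.* WD n b ℤ.+ (+ degB b) - ℤ.1ℤ

InN : (n : ℕ) → ℤ → Basis n → Set
InN n i b = ∃[ j ] ((ℤ.-1ℤ ℤ.≤ j) × (j ℤ.≤ i) × (lev n j b ℤ.≤ j))

InL : (n : ℕ) → ℤ → Basis n → Set
InL n i b = InN n i b × ¬ InN n (i - ℤ.1ℤ) b

HasCard : {A : Set} → (A → Set) → ℕ → Set
HasCard {A} P m =
  Σ[ xs ∈ List A ] (Unique xs × length xs ≡ m × (∀ x → (x ∈ xs) ⇔ P x))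

-- a_m = number of partitions of m
--     = number of Λ ∈ Part(m) with wt(Λ) = m (each λ_t ≤ m necessarily).

vecsUpTo : (j bound : ℕ) → List (Vec ℕ j)
vecsUpTo zero    bound = [] ∷ []
vecsUpTo (suc j) bound =
  concatMap (λ l → Data.List.map (l ∷_) (vecsUpTo j bound)) (upTo (suc bound))

aSeq : ℕ → ℕ
aSeq m = length (filter (λ v → wt v ℕ.≟ m) (vecsUpTo m m))

bNat : ℕ → ℕ
bNat zero    = aSeq 0
bNat (suc m) = bNat m ℕ.+ aSeq (suc m)

cNat : ℕ → ℕ
cNat zero    = bNat 0
cNat (suc m) = cNat m ℕ.+ bNat (suc m)

bSeq : ℤ → ℕ
bSeq (+ m)      = bNat m
bSeq ℤ.-[1+ m ] = 0

-- c_m for m < 0 is never used; set to 0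
cSeq : ℤ → ℕ
cSeq (+ m)      = cNat m
cSeq ℤ.-[1+ m ] = 0

-- Write j = (h_j − 1)(n − 1) + r_j and, for b = x^Λ ∂_k, put e = wt Λ − deg Λ and
-- g = k − 1 − e.  Then lev_j(b) ≤ j reads deg Λ + n − 2 ≤ h_j g + r_j, and b ∈ ℒ_i exactly when
-- deg Λ + n − 2 = h_i g + r_i and g > n − 1 − r_i: comparing with the levels i − 1 and
-- (h_i − 1)(n − 1) forces both, and conversely the right-hand side is then smaller at every
-- earlier level.  For fixed k and e this fixes deg Λ; writing Λ = (λ₁, Λ'), it fixes λ₁, while
-- Λ' is any partition of e into parts ≤ k − 2.  So there are a_e such b as long as e ≤ deg Λ,
-- which is what i > (n − 4)(n − 1), i.e. h_i ≥ n − 3, guarantees.  Summing over e gives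
-- b_{r_i+k−n−1}, and summing over k gives c_{r_i−1}.

module Submission where

open import Defs
open import Data.Nat as ℕ using (ℕ)
open import Data.Integer as ℤ using (ℤ)
open import Data.Product using (_×_)
open import Relation.Binary.PropositionalEquality using (_≡_)

module Cardinality where

  open import Data.Nat using (ℕ; zero; suc; _+_; _≤_; z≤n; s≤s)
  open import Data.Nat.Properties using (<-irrefl; ≤-refl; m≤n⇒m≤1+n; m≤n⇒m<n∨m≡n)
  open import Data.List as List using (List; []; length; filter)
  open import Data.List.Properties using (length-map; length-++)
  open import Data.List.Membership.Propositional using (_∈_)
  open import Data.List.Membership.Propositional.Properties
  open import Data.List.Relation.Unary.Unique.Propositional using (Unique)
  import Data.List.Relation.Unary.Unique.Propositional.Properties as Unique
  open import Data.List.Relation.Unary.AllPairs using ([])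
  open import Data.Product using (∃-syntax; _,_; proj₂)
  open import Data.Sum using (_⊎_; inj₁; inj₂; [_,_]′) renaming (map to ⊎-map)
  open import Data.Empty using (⊥-elim)
  open import Function.Bundles using (mk⇔; Equivalence)
  open import Relation.Binary.PropositionalEquality
  open import Relation.Nullary using (¬_)
  open import Relation.Unary using (Pred; Decidable; Empty; _≐′_; _∪_)
  open import Level using (0ℓ)

  open Equivalence using (to; from)

  module _ {A : Set} where

    HasCard-cong : {P Q : Pred A 0ℓ} {c : ℕ} → P ≐′ Q → HasCard P c → HasCard Q c
    HasCard-cong (P⊆Q , Q⊆P) (xs , uniq , len , mem) =
      xs , uniq , len , λ x → mk⇔ (λ x∈ → P⊆Q x (to (mem x) x∈)) (λ q → from (mem x) (Q⊆P x q))

    HasCard-∅ : {P : Pred A 0ℓ} → Empty P → HasCard P 0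
    HasCard-∅ empty = [] , [] , refl , λ x → mk⇔ (λ ()) (λ p → ⊥-elim (empty x p))

    HasCard-⊎ : {P Q : Pred A 0ℓ} {a b : ℕ} → (∀ x → P x → ¬ Q x) →
                HasCard P a → HasCard Q b → HasCard (P ∪ Q) (a + b)
    HasCard-⊎ disj (xs , uxs , lxs , mxs) (ys , uys , lys , mys) =
      xs List.++ ys ,
      Unique.++⁺ uxs uys (λ {x} (x∈xs , x∈ys) → disj x (to (mxs x) x∈xs) (to (mys x) x∈ys)) ,
      trans (length-++ xs) (cong₂ _+_ lxs lys) ,
      λ x → mk⇔ (λ x∈ → ⊎-map (to (mxs x)) (to (mys x)) (∈-++⁻ xs x∈))
                [ (λ p → ∈-++⁺ˡ (from (mxs x) p)) , (λ q → ∈-++⁺ʳ xs (from (mys x) q)) ]′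

    HasCard-filter : {P : Pred A 0ℓ} (P? : Decidable P) (xs : List A) →
                     Unique xs → (∀ x → P x → x ∈ xs) → HasCard P (length (filter P? xs))
    HasCard-filter P? xs uxs complete =
      filter P? xs , Unique.filter⁺ P? {xs} uxs , refl ,
      λ x → mk⇔ (λ x∈ → proj₂ (∈-filter⁻ P? {xs = xs} x∈)) (λ p → ∈-filter⁺ P? (complete x p) p)

  module _ {A B : Set} {P : Pred A 0ℓ} {Q : Pred B 0ℓ} {c : ℕ} (f : A → B) where

    HasCard-image : (∀ {x y} → f x ≡ f y → x ≡ y) → (∀ x → P x → Q (f x)) →
                    (∀ y → Q y → ∃[ x ] P x × f x ≡ y) → HasCard P c → HasCard Q c
    HasCard-image f-inj P⇒Q Q⇒P (xs , uxs , len , mem) =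
      List.map f xs , Unique.map⁺ f-inj uxs , trans (length-map f xs) len , λ y → mk⇔ (forth y) (back y)
      where
      forth : ∀ y → y ∈ List.map f xs → Q y
      forth y y∈ with ∈-map⁻ f y∈
      ... | x , x∈ , refl = P⇒Q x (to (mem x) x∈)
      back : ∀ y → Q y → y ∈ List.map f xs
      back y q with Q⇒P y q
      ... | x , p , refl = ∈-map⁺ f (from (mem x) p)

  partialSum : (ℕ → ℕ) → ℕ → ℕ
  partialSum c zero    = c zero
  partialSum c (suc F) = partialSum c F + c (suc F)

  bNat≡partialSum : ∀ F → bNat F ≡ partialSum aSeq F
  bNat≡partialSum zero    = refl
  bNat≡partialSum (suc F) = cong (_+ aSeq (suc F)) (bNat≡partialSum F)

  cNat≡partialSum : ∀ F → cNat F ≡ partialSum bNat F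
  cNat≡partialSum zero    = refl
  cNat≡partialSum (suc F) = cong (_+ bNat (suc F)) (cNat≡partialSum F)

  HasCard-⋃≤ : {A : Set} {Q : ℕ → Pred A 0ℓ} {c : ℕ → ℕ} →
               (∀ {e e' x} → Q e x → Q e' x → e ≡ e') →
               ∀ F → (∀ e → e ≤ F → HasCard (Q e) (c e)) →
               HasCard (λ x → ∃[ e ] e ≤ F × Q e x) (partialSum c F)
  HasCard-⋃≤ disj zero count =
    HasCard-cong ((λ x q → 0 , z≤n , q) , λ { x (.0 , z≤n , q) → q }) (count 0 z≤n)
  HasCard-⋃≤ {Q = Q} disj (suc F) count =
    HasCard-cong (join , split)
      (HasCard-⊎ (λ { x (e , e≤F , q) q' → <-irrefl (disj q q') (s≤s e≤F) })
        (HasCard-⋃≤ disj F (λ e e≤F → count e (m≤n⇒m≤1+n e≤F))) (count (suc F) ≤-refl))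
    where
    join : ∀ x → (∃[ e ] e ≤ F × Q e x) ⊎ Q (suc F) x → ∃[ e ] e ≤ suc F × Q e x
    join x (inj₁ (e , e≤F , q)) = e , m≤n⇒m≤1+n e≤F , q
    join x (inj₂ q)             = suc F , ≤-refl , q
    split : ∀ x → ∃[ e ] e ≤ suc F × Q e x → (∃[ e ] e ≤ F × Q e x) ⊎ Q (suc F) x
    split x (e , e≤1+F , q) with m≤n⇒m<n∨m≡n e≤1+F
    ... | inj₁ (s≤s e≤F) = inj₁ (e , e≤F , q)
    ... | inj₂ refl      = inj₂ q

module Partitions where

  open Cardinality
  open import Data.Nat using (ℕ; zero; suc; _+_; _*_; _∸_; _≤_; z≤n; s≤s; _≟_)
  open import Data.Nat.Properties
  open import Data.Nat.Tactic.RingSolver using (solve-∀)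
  open import Data.Vec using (Vec; []; _∷_; _++_; replicate; splitAt)
  open import Data.Vec.Properties using (∷-injective; ∷-injectiveʳ; ++-injectiveˡ)
  open import Data.Vec.Relation.Unary.All using (All; []; _∷_) renaming (map to All-map)
  open import Data.List as List using ([]; _∷_; upTo; cartesianProductWith)
  open import Data.List.Membership.Propositional using (_∈_)
  open import Data.List.Membership.Propositional.Properties using (∈-cartesianProductWith⁺; ∈-upTo⁺)
  open import Data.List.Relation.Unary.Unique.Propositional using (Unique)
  import Data.List.Relation.Unary.Unique.Propositional.Properties as Unique
  open import Data.List.Relation.Unary.Any using (here)
  open import Data.List.Relation.Unary.AllPairs using ([]; _∷_)
  import Data.List.Relation.Unary.All as ListAll
  open import Data.Product using (∃-syntax; _,_)
  open import Data.Empty using (⊥-elim)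
  open import Relation.Binary.PropositionalEquality

  vecsUpTo-suc : ∀ j b → vecsUpTo (suc j) b ≡ cartesianProductWith _∷_ (upTo (suc b)) (vecsUpTo j b)
  vecsUpTo-suc j b = go (upTo (suc b))
    where
    go : ∀ xs → List.concatMap (λ l → List.map (l ∷_) (vecsUpTo j b)) xs
              ≡ cartesianProductWith _∷_ xs (vecsUpTo j b)
    go []       = refl
    go (x ∷ xs) = cong (List.map (x ∷_) (vecsUpTo j b) List.++_) (go xs)

  vecsUpTo-unique : ∀ j b → Unique (vecsUpTo j b)
  vecsUpTo-unique zero    b = ListAll.[] ∷ []
  vecsUpTo-unique (suc j) b rewrite vecsUpTo-suc j b =
    Unique.cartesianProductWith⁺ _∷_ ∷-injective (Unique.upTo⁺ (suc b)) (vecsUpTo-unique j b)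

  ∈-vecsUpTo : ∀ {j b} {v : Vec ℕ j} → All (_≤ b) v → v ∈ vecsUpTo j b
  ∈-vecsUpTo []                             = here refl
  ∈-vecsUpTo {suc j} {b} (l≤b ∷ v≤b) rewrite vecsUpTo-suc j b =
    ∈-cartesianProductWith⁺ _∷_ (∈-upTo⁺ (s≤s l≤b)) (∈-vecsUpTo v≤b)

  All-≤-wtFrom : ∀ {j} s (v : Vec ℕ j) → All (_≤ wtFrom (suc s) v) v
  All-≤-wtFrom s []      = []
  All-≤-wtFrom s (l ∷ v) =
    ≤-trans (m≤m+n l (s * l)) (m≤m+n _ _) ∷
    All-map (λ p → ≤-trans p (m≤n+m _ (suc s * l))) (All-≤-wtFrom (suc s) v)

  aSeq-count : ∀ e → HasCard (λ (v : Vec ℕ e) → wt v ≡ e) (aSeq e)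
  aSeq-count e = HasCard-filter (λ v → wt v ≟ e) (vecsUpTo e e) (vecsUpTo-unique e e)
    (λ v wt≡e → ∈-vecsUpTo (subst (λ w → All (_≤ w) v) wt≡e (All-≤-wtFrom 0 v)))

  wtFrom-suc : ∀ {j} s (v : Vec ℕ j) → wtFrom (suc s) v ≡ deg v + wtFrom s v
  wtFrom-suc s []      = refl
  wtFrom-suc s (l ∷ v) = begin
    suc s * l + wtFrom (suc (suc s)) v   ≡⟨ cong (suc s * l +_) (wtFrom-suc (suc s) v) ⟩
    suc s * l + (deg v + wtFrom (suc s) v) ≡⟨ lemma s l (deg v) (wtFrom (suc s) v) ⟩
    (l + deg v) + (s * l + wtFrom (suc s) v) ∎
    where
    open ≡-Reasoning
    lemma : ∀ s l d w → suc s * l + (d + w) ≡ (l + d) + (s * l + w)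
    lemma = solve-∀

  wt≡deg+wtFrom0 : ∀ {j} (v : Vec ℕ j) → wt v ≡ deg v + wtFrom 0 v
  wt≡deg+wtFrom0 = wtFrom-suc 0

  deg≤wt : ∀ {j} (v : Vec ℕ j) → deg v ≤ wt v
  deg≤wt v = subst (deg v ≤_) (sym (wt≡deg+wtFrom0 v)) (m≤m+n (deg v) (wtFrom 0 v))

  *-deg≤wtFrom : ∀ {j} s (v : Vec ℕ j) → s * deg v ≤ wtFrom s v
  *-deg≤wtFrom s []      = ≤-reflexive (*-zeroʳ s)
  *-deg≤wtFrom s (l ∷ v) = begin
    s * (l + deg v)          ≡⟨ *-distribˡ-+ s l (deg v) ⟩
    s * l + s * deg v        ≤⟨ +-monoʳ-≤ (s * l) (m≤n+m (s * deg v) (deg v)) ⟩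
    s * l + suc s * deg v    ≤⟨ +-monoʳ-≤ (s * l) (*-deg≤wtFrom (suc s) v) ⟩
    s * l + wtFrom (suc s) v ∎
    where open ≤-Reasoning

  wtFrom≤*deg : ∀ {j} s (v : Vec ℕ j) → wtFrom (suc s) v ≤ (s + j) * deg v
  wtFrom≤*deg s []              = z≤n
  wtFrom≤*deg {suc j} s (l ∷ v) = begin
    suc s * l + wtFrom (suc (suc s)) v  ≤⟨ +-mono-≤ (*-monoˡ-≤ l (s≤s (m≤m+n s j)))
                                                     (wtFrom≤*deg (suc s) v) ⟩
    suc (s + j) * l + suc (s + j) * deg v ≡⟨ sym (*-distribˡ-+ (suc (s + j)) l (deg v)) ⟩
    suc (s + j) * (l + deg v)            ≡⟨ cong (_* (l + deg v)) (sym (+-suc s j)) ⟩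
    (s + suc j) * (l + deg v)            ∎
    where open ≤-Reasoning

  wtFrom-++ : ∀ {a b} s (v : Vec ℕ a) (w : Vec ℕ b) → wtFrom s (v ++ w) ≡ wtFrom s v + wtFrom (s + a) w
  wtFrom-++ s []              w = cong (λ t → wtFrom t w) (sym (+-identityʳ s))
  wtFrom-++ {suc a} s (l ∷ v) w = begin
    s * l + wtFrom (suc s) (v ++ w)                   ≡⟨ cong (s * l +_) (wtFrom-++ (suc s) v w) ⟩
    s * l + (wtFrom (suc s) v + wtFrom (suc s + a) w) ≡⟨ sym (+-assoc (s * l) _ _) ⟩
    s * l + wtFrom (suc s) v + wtFrom (suc s + a) w
      ≡⟨ cong (λ t → s * l + wtFrom (suc s) v + wtFrom t w) (sym (+-suc s a)) ⟩
    s * l + wtFrom (suc s) v + wtFrom (s + suc a) w   ∎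
    where open ≡-Reasoning

  wtFrom-replicate-0 : ∀ s p → wtFrom s (replicate p 0) ≡ 0
  wtFrom-replicate-0 s zero    = refl
  wtFrom-replicate-0 s (suc p) = trans (cong (_+ wtFrom (suc s) (replicate p 0)) (*-zeroʳ s)) (wtFrom-replicate-0 (suc s) p)

  deg≡0⇒≡replicate : ∀ {j} (w : Vec ℕ j) → deg w ≡ 0 → w ≡ replicate j 0
  deg≡0⇒≡replicate []      _     = refl
  deg≡0⇒≡replicate (l ∷ w) deg≡0 rewrite m+n≡0⇒m≡0 l deg≡0 =
    cong (0 ∷_) (deg≡0⇒≡replicate w (m+n≡0⇒n≡0 l deg≡0))

  -- Entries beyond position e each contribute more than e to the weight.
  wt-++≤⇒deg≡0 : ∀ {e p} (v : Vec ℕ e) (w : Vec ℕ p) → wt (v ++ w) ≤ e → deg w ≡ 0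
  wt-++≤⇒deg≡0 {e} v w wt≤e with deg w in deg≡ | *-deg≤wtFrom (suc e) w
  ... | zero  | _       = refl
  ... | suc d | tail≥ = ⊥-elim (<-irrefl refl (begin-strict
    e                          <⟨ ≤-refl ⟩
    suc e                      ≤⟨ m≤m*n (suc e) (suc d) ⟩
    suc e * suc d              ≤⟨ tail≥ ⟩
    wtFrom (suc e) w           ≤⟨ m≤n+m _ (wt v) ⟩
    wt v + wtFrom (1 + e) w    ≡⟨ sym (wtFrom-++ 1 v w) ⟩
    wt (v ++ w)                ≤⟨ wt≤e ⟩
    e                          ∎))
    where open ≤-Reasoning

  partitions-count : ∀ {e K} → e ≤ K → HasCard (λ (t : Vec ℕ K) → wt t ≡ e) (aSeq e)
  partitions-count {e} {K} e≤K =
    subst (λ K → HasCard (λ (t : Vec ℕ K) → wt t ≡ e) (aSeq e)) (m+[n∸m]≡n e≤K) (padded (K ∸ e))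
    where
    wt-pad : ∀ {a} p (v : Vec ℕ a) → wt (v ++ replicate p 0) ≡ wt v
    wt-pad {a} p v = begin
      wt (v ++ replicate p 0)                   ≡⟨ wtFrom-++ 1 v (replicate p 0) ⟩
      wt v + wtFrom (suc a) (replicate p 0)     ≡⟨ cong (wt v +_) (wtFrom-replicate-0 (suc a) p) ⟩
      wt v + 0                                  ≡⟨ +-identityʳ (wt v) ⟩
      wt v                                      ∎
      where open ≡-Reasoning
    padded : ∀ p → HasCard (λ (t : Vec ℕ (e + p)) → wt t ≡ e) (aSeq e)
    padded p = HasCard-image (_++ replicate p 0) (λ {v} {v'} → ++-injectiveˡ v v')
      (λ v wt≡e → trans (wt-pad p v) wt≡e) unpad (aSeq-count e)
      where
      unpad : ∀ t → wt t ≡ e → ∃[ v ] wt v ≡ e × v ++ replicate p 0 ≡ t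
      unpad t wt≡e with splitAt e t
      ... | v , w , refl with deg≡0⇒≡replicate w (wt-++≤⇒deg≡0 v w (≤-reflexive wt≡e))
      ... | refl = v , trans (sym (wt-pad p v)) wt≡e , refl

  -- The excess wt − deg of (l ∷ t) is wt t, whatever l is.
  excess-count : ∀ {K e D} → e ≤ K → e ≤ D →
                 HasCard (λ (Λ : Vec ℕ (suc K)) → wt Λ ≡ deg Λ + e × deg Λ ≡ D) (aSeq e)
  excess-count {K} {e} {D} e≤K e≤D =
    HasCard-image (λ t → D ∸ deg t ∷ t) ∷-injectiveʳ forth back (partitions-count e≤K)
    where
    forth : ∀ t → wt t ≡ e → wt (D ∸ deg t ∷ t) ≡ deg (D ∸ deg t ∷ t) + e × deg (D ∸ deg t ∷ t) ≡ D
    forth t wt≡e = trans (wt≡deg+wtFrom0 (D ∸ deg t ∷ t)) (cong (_ +_) wt≡e) ,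
                   m∸n+n≡m (≤-trans (deg≤wt t) (≤-trans (≤-reflexive wt≡e) e≤D))
    back : ∀ Λ → wt Λ ≡ deg Λ + e × deg Λ ≡ D → ∃[ t ] wt t ≡ e × D ∸ deg t ∷ t ≡ Λ
    back (l ∷ t) (wt≡ , deg≡) =
      t , +-cancelˡ-≡ (deg (l ∷ t)) (wt t) e (trans (sym (wt≡deg+wtFrom0 (l ∷ t))) wt≡) ,
      cong (_∷ t) (trans (cong (_∸ deg t) (sym deg≡)) (m+n∸n≡m l (deg t)))

module LevelShapes where

  open Cardinality
  open Partitions
  open import Data.Nat using (ℕ; zero; suc; _+_; _*_; _∸_; _≤_; _<_; z≤n; s≤s)
  open import Data.Nat.Properties
  open import Data.Nat.Tactic.RingSolver using (solve-∀)
  open import Data.Product using (∃-syntax; _,_; proj₁)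
  open import Function.Bundles using (_⇔_; mk⇔)
  open import Relation.Binary.PropositionalEquality
  open import Relation.Unary using (Pred; Empty; _≐′_)

  -- With h = h_i and σ = n − 1 − r_i, x^Λ ∂_(k+1) ∈ ℒ_i iff OnLevel h σ Λ (InL⇔OnLevel);
  -- here e = wt Λ − deg Λ and g = k − e.
  OnLevel : ℕ → ℕ → ∀ {k} → Part k → Set
  OnLevel h σ {k} Λ = ∃[ e ] ∃[ g ] wt Λ ≡ deg Λ + e × k ≡ e + g × σ < g × deg Λ + σ ≡ h * g + 1

  OnLevel⇒σ<k : ∀ {h σ k} {Λ : Part k} → OnLevel h σ Λ → σ < k
  OnLevel⇒σ<k (e , g , _ , k≡e+g , σ<g , _) = ≤-trans σ<g (≤-trans (m≤n+m g e) (≤-reflexive (sym k≡e+g)))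

  OnLevel-empty : ∀ {h σ k} → k ≤ σ → Empty (OnLevel h σ {k})
  OnLevel-empty {h} k≤σ Λ onLevel = <⇒≱ (OnLevel⇒σ<k {h} {Λ = Λ} onLevel) k≤σ

  σ+m≤m*[1+σ] : ∀ {σ m} → σ ≤ m → σ + m ≤ m * suc σ
  σ+m≤m*[1+σ] {σ} {zero}   σ≤0 rewrite n≤0⇒n≡0 σ≤0 = z≤n
  σ+m≤m*[1+σ] {σ} {suc m} _ = begin
    σ + suc m         ≡⟨ +-suc σ m ⟩
    suc σ + m         ≤⟨ +-monoʳ-≤ (suc σ) (m≤m*n m (suc σ)) ⟩
    suc σ + m * suc σ ∎
    where open ≤-Reasoning

  σ+e≤h*g+1 : ∀ {h σ m e g} → σ ≤ m → m ≤ suc h → e + g ≤ suc m → σ < g → σ + e ≤ h * g + 1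
  σ+e≤h*g+1 {h} {σ} {m} {e} {g} σ≤m m≤1+h e+g≤1+m σ<g = +-cancelʳ-≤ g (σ + e) (h * g + 1) (begin
    σ + e + g        ≡⟨ +-assoc σ e g ⟩
    σ + (e + g)      ≤⟨ +-monoʳ-≤ σ e+g≤1+m ⟩
    σ + suc m        ≡⟨ +-suc σ m ⟩
    suc (σ + m)      ≤⟨ s≤s (σ+m≤m*[1+σ] σ≤m) ⟩
    suc (m * suc σ)  ≤⟨ s≤s (*-mono-≤ m≤1+h σ<g) ⟩
    suc (suc h * g)  ≡⟨ lemma h g ⟩
    h * g + 1 + g    ∎)
    where
    open ≤-Reasoning
    lemma : ∀ h g → suc (suc h * g) ≡ h * g + 1 + g
    lemma = solve-∀

  module _ {h σ E : ℕ} where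

    private
      k : ℕ
      k = suc (σ + E)

      g[_] : ℕ → ℕ
      g[ e ] = suc (σ + (E ∸ e))

      Piece : ℕ → Pred (Part k) _
      Piece e Λ = wt Λ ≡ deg Λ + e × deg Λ + σ ≡ h * g[ e ] + 1

      e+g[e]≡k : ∀ {e} → e ≤ E → e + g[ e ] ≡ k
      e+g[e]≡k {e} e≤E = begin
        e + suc (σ + (E ∸ e))   ≡⟨ lemma e σ (E ∸ e) ⟩
        suc (σ + (e + (E ∸ e))) ≡⟨ cong (λ t → suc (σ + t)) (m+[n∸m]≡n e≤E) ⟩
        k                       ∎
        where
        open ≡-Reasoning
        lemma : ∀ e σ x → e + suc (σ + x) ≡ suc (σ + (e + x))
        lemma = solve-∀

      ⋃Piece≐OnLevel : (λ Λ → ∃[ e ] e ≤ E × Piece e Λ) ≐′ OnLevel h σ {k}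
      ⋃Piece≐OnLevel = join , split
        where
        split : ∀ Λ → OnLevel h σ Λ → ∃[ e ] e ≤ E × Piece e Λ
        split Λ (e , g , wt≡ , k≡e+g , σ<g , deg≡) = e , e≤E , wt≡ , trans deg≡ (cong (λ g → h * g + 1) g≡)
          where
          e≤E : e ≤ E
          e≤E = +-cancelʳ-≤ (suc σ) e E (begin
            e + suc σ   ≤⟨ +-monoʳ-≤ e σ<g ⟩
            e + g       ≡⟨ sym k≡e+g ⟩
            suc (σ + E) ≡⟨ cong suc (+-comm σ E) ⟩
            suc (E + σ) ≡⟨ sym (+-suc E σ) ⟩
            E + suc σ   ∎)
            where open ≤-Reasoning
          g≡ : g ≡ g[ e ]
          g≡ = +-cancelˡ-≡ e g g[ e ] (trans (sym k≡e+g) (sym (e+g[e]≡k e≤E)))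
        join : ∀ Λ → ∃[ e ] e ≤ E × Piece e Λ → OnLevel h σ Λ
        join Λ (e , e≤E , wt≡ , deg≡) =
          e , g[ e ] , wt≡ , sym (e+g[e]≡k e≤E) , s≤s (m≤m+n σ (E ∸ e)) , deg≡

      Piece-count : (∀ e g → e + g ≡ k → σ < g → σ + e ≤ h * g + 1) →
                    ∀ e → e ≤ E → HasCard (Piece e) (aSeq e)
      Piece-count admissible e e≤E = HasCard-cong (deg≡∸⇒ , ⇒deg≡∸)
        (excess-count (≤-trans e≤E (m≤n+m E σ)) (m+n≤o⇒m≤o∸n e (subst (_≤ X) (+-comm σ e) σ+e≤X)))
        where
        X = h * g[ e ] + 1
        σ+e≤X : σ + e ≤ X
        σ+e≤X = admissible e g[ e ] (e+g[e]≡k e≤E) (s≤s (m≤m+n σ (E ∸ e)))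
        deg≡∸⇒ : ∀ (Λ : Part k) → wt Λ ≡ deg Λ + e × deg Λ ≡ X ∸ σ → Piece e Λ
        deg≡∸⇒ Λ (wt≡ , deg≡) = wt≡ , trans (cong (_+ σ) deg≡) (m∸n+n≡m (m+n≤o⇒m≤o σ σ+e≤X))
        ⇒deg≡∸ : ∀ (Λ : Part k) → Piece e Λ → wt Λ ≡ deg Λ + e × deg Λ ≡ X ∸ σ
        ⇒deg≡∸ Λ (wt≡ , deg≡) = wt≡ , trans (sym (m+n∸n≡m (deg Λ) σ)) (cong (_∸ σ) deg≡)

    OnLevel-count : (∀ e g → e + g ≡ suc (σ + E) → σ < g → σ + e ≤ h * g + 1) →
                    HasCard (OnLevel h σ {suc (σ + E)}) (bNat E)
    OnLevel-count admissible = subst (HasCard (OnLevel h σ)) (sym (bNat≡partialSum E))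
      (HasCard-cong ⋃Piece≐OnLevel
        (HasCard-⋃≤ (λ {e} {e'} {Λ} p p' → +-cancelˡ-≡ (deg Λ) e e' (trans (sym (proj₁ p)) (proj₁ p')))
          E (Piece-count admissible)))

  OnLevel⇔ : ∀ {h σ k} (Λ : Part k) →
             OnLevel h σ Λ ⇔ (∃[ g ] k ≡ wtFrom 0 Λ + g × σ < g × deg Λ + σ ≡ h * g + 1)
  OnLevel⇔ {h} {σ} {k} Λ = mk⇔ forth (λ (g , rest) → wtFrom 0 Λ , g , wt≡deg+wtFrom0 Λ , rest)
    where
    forth : OnLevel h σ Λ → ∃[ g ] k ≡ wtFrom 0 Λ + g × σ < g × deg Λ + σ ≡ h * g + 1
    forth (e , g , wt≡ , k≡e+g , rest) = g , trans k≡e+g (cong (_+ g) e≡) , rest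
      where
      e≡ : e ≡ wtFrom 0 Λ
      e≡ = +-cancelˡ-≡ (deg Λ) e (wtFrom 0 Λ) (trans (sym wt≡) (wt≡deg+wtFrom0 Λ))

-- Opened only from here on: with +_ in scope, ℕ sections such as (x +_) above become ambiguous.
open import Data.Nat using (suc; z≤n; s≤s)
open import Data.Integer using (+_; _-_)
open import Data.Product using (_,_)

module IntegerOrder where

  open import Data.Integer using (_+_; _-_; 0ℤ; 1ℤ; -1ℤ; _≤_; _<_)
  open import Data.Integer.Properties
  open import Data.Integer.Tactic.RingSolver using (solve-∀)
  open import Relation.Binary.PropositionalEquality

  -- Linear facts are obtained by comparing differences, which the ring solver can rearrange.
  ≤-by-diff : ∀ {x y x' y'} → x - y ≡ x' - y' → x ≤ y → x' ≤ y'
  ≤-by-diff eq x≤y = i-j≤0⇒i≤j (subst (_≤ 0ℤ) eq (i≤j⇒i-j≤0 x≤y))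

  <-by-diff : ∀ {x y x' y'} → x - y ≡ x' - y' → x < y → x' < y'
  <-by-diff {x} {y} {x'} {y'} eq x<y = suc[i]≤j⇒i<j (≤-by-diff suc-eq (i<j⇒suc[i]≤j x<y))
    where
    lemma : ∀ x y → (1ℤ + x) - y ≡ 1ℤ + (x - y)
    lemma = solve-∀
    suc-eq : (1ℤ + x) - y ≡ (1ℤ + x') - y'
    suc-eq = trans (lemma x y) (trans (cong (λ d → 1ℤ + d) eq) (sym (lemma x' y')))

  ≡-by-diff : ∀ {x y x' y'} → x - y ≡ x' - y' → x ≡ y → x' ≡ y'
  ≡-by-diff {x} {y} {x'} {y'} eq x≡y =
    ≤-antisym (≤-by-diff eq (≤-reflexive x≡y)) (≤-by-diff swapped (≤-reflexive (sym x≡y)))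
    where
    flip : ∀ a b → a - b ≡ 0ℤ - (b - a)
    flip = solve-∀
    swapped : y - x ≡ y' - x'
    swapped = trans (flip y x) (trans (cong (0ℤ -_) eq) (sym (flip y' x')))

  squeeze : ∀ {a b} → a - 1ℤ < b → b ≤ a → b ≡ a
  squeeze {a} {b} a-1<b b≤a = ≤-antisym b≤a (≤-by-diff (lemma a b) (i<j⇒suc[i]≤j a-1<b))
    where
    lemma : ∀ a b → (1ℤ + (a - 1ℤ)) - b ≡ a - b
    lemma = solve-∀

  <⇒≤-1 : ∀ {a b} → a < b → a ≤ b - 1ℤ
  <⇒≤-1 {a} {b} a<b = ≤-by-diff (lemma a b) (i<j⇒suc[i]≤j a<b)
    where
    lemma : ∀ a b → (1ℤ + a) - b ≡ a - (b - 1ℤ)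
    lemma = solve-∀

  ≤-1⇒< : ∀ {a b} → a ≤ b - 1ℤ → a < b
  ≤-1⇒< {a} {b} a≤b-1 = suc[i]≤j⇒i<j (≤-by-diff (lemma a b) a≤b-1)
    where
    lemma : ∀ a b → a - (b - 1ℤ) ≡ (1ℤ + a) - b
    lemma = solve-∀

  0≤i⇒-1≤i-1 : ∀ {i} → 0ℤ ≤ i → -1ℤ ≤ i - 1ℤ
  0≤i⇒-1≤i-1 {i} = ≤-by-diff (lemma i)
    where
    lemma : ∀ i → 0ℤ - i ≡ -1ℤ - (i - 1ℤ)
    lemma = solve-∀

module Blocks (M : ℤ) (1≤M : ℤ.1ℤ ℤ.≤ M) (H R : ℤ → ℤ)
              (H-R-decomp : ∀ j → j ≡ (H j - ℤ.1ℤ) ℤ.* M ℤ.+ R j)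
              (1≤R : ∀ j → ℤ.1ℤ ℤ.≤ R j) (R≤M : ∀ j → R j ℤ.≤ M) where

  open IntegerOrder
  open import Data.Integer using (_+_; _-_; _*_; 0ℤ; 1ℤ; -1ℤ; _≤_; _<_; +≤+; -≤+; nonNegative)
  open import Data.Integer.Properties
  open import Data.Integer.Tactic.RingSolver using (solve-∀)
  open import Data.Nat using (z≤n)
  open import Data.Product using (_,_; proj₁; proj₂)
  open import Data.Empty using (⊥-elim)
  open import Relation.Binary using (tri<; tri≈; tri>)
  open import Relation.Binary.PropositionalEquality
  open import Relation.Nullary using (yes; no)

  block : ℤ → ℤ → ℤ
  block h r = (h - 1ℤ) * M + r

  private
    0≤M : 0ℤ ≤ M
    0≤M = ≤-trans (+≤+ z≤n) 1≤M

  block-< : ∀ {h h' r r'} → h < h' → r ≤ M → 1ℤ ≤ r' → block h r < block h' r'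
  block-< {h} {h'} {r} {r'} h<h' r≤M 1≤r' = begin-strict
    (h - 1ℤ) * M + r    ≤⟨ +-monoʳ-≤ ((h - 1ℤ) * M) r≤M ⟩
    (h - 1ℤ) * M + M    ≡⟨ lemma₁ h M ⟩
    h * M               ≤⟨ *-monoʳ-≤-nonNeg M {{nonNegative 0≤M}} (<⇒≤-1 h<h') ⟩
    (h' - 1ℤ) * M       <⟨ suc[i]≤j⇒i<j (≤-by-diff (lemma₂ ((h' - 1ℤ) * M) r') 1≤r') ⟩
    (h' - 1ℤ) * M + r'  ∎
    where
    open ≤-Reasoning
    lemma₁ : ∀ h M → (h - 1ℤ) * M + M ≡ h * M
    lemma₁ = solve-∀
    lemma₂ : ∀ x r → 1ℤ - r ≡ (1ℤ + x) - (x + r)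
    lemma₂ = solve-∀

  block-unique : ∀ {h r} → 1ℤ ≤ r → r ≤ M → H (block h r) ≡ h × R (block h r) ≡ r
  block-unique {h} {r} 1≤r r≤M with <-cmp (H (block h r)) h
  ... | tri< Hj<h _ _ = ⊥-elim (<-irrefl (sym (H-R-decomp _)) (block-< Hj<h (R≤M _) 1≤r))
  ... | tri> _ _ h<Hj = ⊥-elim (<-irrefl (H-R-decomp _) (block-< h<Hj r≤M (1≤R _)))
  ... | tri≈ _ Hj≡h _ = Hj≡h , (begin
    R j                         ≡⟨ lemma (H j) (R j) M ⟩
    ((H j - 1ℤ) * M + R j) - (H j - 1ℤ) * M ≡⟨ cong₂ (λ x y → x - (y - 1ℤ) * M) (sym (H-R-decomp j)) Hj≡h ⟩
    block h r - (h - 1ℤ) * M   ≡⟨ lemma h r M ⟨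
    r                          ∎)
    where
    open ≡-Reasoning
    j = block h r
    lemma : ∀ h r M → r ≡ ((h - 1ℤ) * M + r) - (h - 1ℤ) * M
    lemma = solve-∀

  0≤i⇒0≤H : ∀ {i} → 0ℤ ≤ i → 0ℤ ≤ H i
  0≤i⇒0≤H {i} 0≤i = ≮⇒≥ λ Hi<0 → <⇒≱ (begin-strict
    i                 ≡⟨ H-R-decomp i ⟩
    block (H i) (R i) <⟨ block-< Hi<0 (R≤M i) ≤-refl ⟩
    block 0ℤ 1ℤ       ≤⟨ ≤-by-diff (lemma M) 1≤M ⟩
    0ℤ                ∎) 0≤i
    where
    open ≤-Reasoning
    lemma : ∀ M → 1ℤ - M ≡ ((0ℤ - 1ℤ) * M + 1ℤ) - 0ℤ
    lemma = solve-∀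

  0≤i∧H≡0⇒R≡M : ∀ {i} → 0ℤ ≤ i → H i ≡ 0ℤ → R i ≡ M
  0≤i∧H≡0⇒R≡M {i} 0≤i Hi≡0 = ≤-antisym (R≤M i) (≤-by-diff (begin
    0ℤ - i                                  ≡⟨ cong (0ℤ -_) (H-R-decomp i) ⟩
    0ℤ - ((H i - 1ℤ) * M + R i)             ≡⟨ cong (λ h → 0ℤ - ((h - 1ℤ) * M + R i)) Hi≡0 ⟩
    0ℤ - ((0ℤ - 1ℤ) * M + R i)              ≡⟨ lemma M (R i) ⟩
    M - R i                                 ∎) 0≤i)
    where
    open ≡-Reasoning
    lemma : ∀ M r → 0ℤ - ((0ℤ - 1ℤ) * M + r) ≡ M - r
    lemma = solve-∀

  module _ (G : ℤ) where

    -- For G = slope b, lev_j(b) ≤ j iff deg + n − 2 ≤ φ j (lev≤⇔).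
    φ : ℤ → ℤ
    φ j = H j * G + R j

    φ-block : ∀ {h r} → 1ℤ ≤ r → r ≤ M → φ (block h r) ≡ h * G + r
    φ-block {h} {r} 1≤r r≤M = cong₂ (λ x y → x * G + y) (proj₁ unique) (proj₂ unique)
      where unique = block-unique {h} 1≤r r≤M

    φ-< : ∀ {i j} → M + 1ℤ - R i ≤ G → j < i → φ j < φ i
    φ-< {i} {j} bound j<i with <-cmp (H j) (H i)
    ... | tri< Hj<Hi _ _ = begin-strict
      H j * G + R j          ≤⟨ +-mono-≤ (*-monoʳ-≤-nonNeg G {{nonNegative 0≤G}} (<⇒≤-1 Hj<Hi)) (R≤M j) ⟩
      (H i - 1ℤ) * G + M     <⟨ suc[i]≤j⇒i<j (≤-by-diff (lemma (H i) G M (R i)) bound) ⟩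
      H i * G + R i          ∎
      where
      open ≤-Reasoning
      0≤G : 0ℤ ≤ G
      0≤G = ≤-trans (+≤+ z≤n) (≤-trans (≤-by-diff (lemma₀ M (R i)) (R≤M i)) bound)
        where
        lemma₀ : ∀ M r → r - M ≡ 1ℤ - (M + 1ℤ - r)
        lemma₀ = solve-∀
      lemma : ∀ h G M r → (M + 1ℤ - r) - G ≡ (1ℤ + ((h - 1ℤ) * G + M)) - (h * G + r)
      lemma = solve-∀
    ... | tri≈ _ Hj≡Hi _ = subst (λ h → h * G + R j < H i * G + R i) (sym Hj≡Hi)
      (+-monoʳ-< (H i * G) (<-by-diff (begin
        j - i                                          ≡⟨ cong₂ _-_ (H-R-decomp j) (H-R-decomp i) ⟩
        ((H j - 1ℤ) * M + R j) - ((H i - 1ℤ) * M + R i)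
          ≡⟨ cong (λ h → ((h - 1ℤ) * M + R j) - ((H i - 1ℤ) * M + R i)) Hj≡Hi ⟩
        ((H i - 1ℤ) * M + R j) - ((H i - 1ℤ) * M + R i) ≡⟨ lemma (H i) M (R j) (R i) ⟩
        R j - R i                                      ∎) j<i))
      where
      open ≡-Reasoning
      lemma : ∀ h M r r' → ((h - 1ℤ) * M + r) - ((h - 1ℤ) * M + r') ≡ r - r'
      lemma = solve-∀
    ... | tri> _ _ Hi<Hj = ⊥-elim (<-asym j<i (subst₂ _<_ (sym (H-R-decomp i)) (sym (H-R-decomp j))
                                                 (block-< Hi<Hj (R≤M i) (1≤R j))))


    -- Entering at i means T ≤ φ i but φ (i − 1) < T.  Inside a block φ (i − 1) = φ i − 1;
    -- across a block boundary (R i = 1) the bound G ≤ M forces G = M and again φ (i − 1) = φ i − 1.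
    entry-φ≡T : ∀ {i T} → G ≤ M → T ≤ φ i → φ (i - 1ℤ) < T → φ i ≡ T
    entry-φ≡T {i} {T} G≤M T≤φi φ[i-1]<T with R i ≟ 1ℤ
    ... | no Ri≢1 = sym (squeeze (subst (_< T) φ[i-1]≡φi-1 φ[i-1]<T) T≤φi)
      where
      1≤Ri-1 : 1ℤ ≤ R i - 1ℤ
      1≤Ri-1 = <⇒≤-1 (≤∧≢⇒< (1≤R i) (λ 1≡Ri → Ri≢1 (sym 1≡Ri)))
      lemma₁ : ∀ h M r → ((h - 1ℤ) * M + r) - 1ℤ ≡ (h - 1ℤ) * M + (r - 1ℤ)
      lemma₁ = solve-∀
      lemma₂ : ∀ h G r → h * G + (r - 1ℤ) ≡ (h * G + r) - 1ℤ
      lemma₂ = solve-∀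
      φ[i-1]≡φi-1 : φ (i - 1ℤ) ≡ φ i - 1ℤ
      φ[i-1]≡φi-1 = begin
        φ (i - 1ℤ)                  ≡⟨ cong (λ x → φ (x - 1ℤ)) (H-R-decomp i) ⟩
        φ (block (H i) (R i) - 1ℤ)  ≡⟨ cong φ (lemma₁ (H i) M (R i)) ⟩
        φ (block (H i) (R i - 1ℤ))  ≡⟨ φ-block {H i} 1≤Ri-1 (≤-trans (i-j≤i (R i) 1ℤ) (R≤M i)) ⟩
        H i * G + (R i - 1ℤ)        ≡⟨ lemma₂ (H i) G (R i) ⟩
        φ i - 1ℤ                    ∎
        where open ≡-Reasoning
    ... | yes Ri≡1 = trans (cong (λ r → H i * G + r) Ri≡1) (sym (squeeze
      (subst (_< T) (trans φ[i-1]≡ (trans (cong (λ x → (H i - 1ℤ) * G + x) M≡G) (lemma₃ (H i) G)))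
             φ[i-1]<T)
      T≤hG+1))
      where
      lemma₁ : ∀ h M → ((h - 1ℤ) * M + 1ℤ) - 1ℤ ≡ ((h - 1ℤ) - 1ℤ) * M + M
      lemma₁ = solve-∀
      lemma₂ : ∀ h G M → (1ℤ + ((h - 1ℤ) * G + M)) - (h * G + 1ℤ) ≡ M - G
      lemma₂ = solve-∀
      lemma₃ : ∀ h G → (h - 1ℤ) * G + G ≡ (h * G + 1ℤ) - 1ℤ
      lemma₃ = solve-∀
      φ[i-1]≡ : φ (i - 1ℤ) ≡ (H i - 1ℤ) * G + M
      φ[i-1]≡ = begin
        φ (i - 1ℤ)                  ≡⟨ cong (λ x → φ (x - 1ℤ)) (H-R-decomp i) ⟩
        φ (block (H i) (R i) - 1ℤ)  ≡⟨ cong (λ r → φ (block (H i) r - 1ℤ)) Ri≡1 ⟩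
        φ (block (H i) 1ℤ - 1ℤ)     ≡⟨ cong φ (lemma₁ (H i) M) ⟩
        φ (block (H i - 1ℤ) M)      ≡⟨ φ-block {H i - 1ℤ} 1≤M ≤-refl ⟩
        (H i - 1ℤ) * G + M          ∎
        where open ≡-Reasoning
      T≤hG+1 : T ≤ H i * G + 1ℤ
      T≤hG+1 = subst (λ r → T ≤ H i * G + r) Ri≡1 T≤φi
      M≡G : M ≡ G
      M≡G = ≤-antisym (≤-by-diff (lemma₂ (H i) G M)
                        (i<j⇒suc[i]≤j (<-≤-trans (subst (_< T) φ[i-1]≡ φ[i-1]<T) T≤hG+1))) G≤M

    -- Compare with the last index j₀ of the previous block.  There is none when H i = 0; then
    -- R i = M, so T = M.
    entry-slope-bound : ∀ {i T} → 0ℤ ≤ i → (T ≡ M → 1ℤ ≤ G) → φ i ≡ T →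
                        (∀ j → -1ℤ ≤ j → j ≤ i - 1ℤ → φ j < T) → M + 1ℤ - R i ≤ G
    entry-slope-bound {i} {T} 0≤i T≡M⇒1≤G φi≡T φ<T with 1ℤ ≤? H i
    ... | yes 1≤Hi = ≤-by-diff (lemma₁ (H i) G M (R i)) (i<j⇒suc[i]≤j
          (subst₂ _<_ (φ-block {H i - 1ℤ} 1≤M ≤-refl) (sym φi≡T) (φ<T j₀ -1≤j₀ j₀≤i-1)))
      where
      j₀ = block (H i - 1ℤ) M
      lemma₁ : ∀ h G M r → (1ℤ + ((h - 1ℤ) * G + M)) - (h * G + r) ≡ (M + 1ℤ - r) - G
      lemma₁ = solve-∀
      lemma₂ : ∀ h M → (h - 1ℤ) * M ≡ ((h - 1ℤ) - 1ℤ) * M + M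
      lemma₂ = solve-∀
      lemma₃ : ∀ h → 1ℤ - h ≡ 0ℤ - (h - 1ℤ)
      lemma₃ = solve-∀
      lemma₄ : ∀ h M r → 1ℤ - r ≡ (((h - 1ℤ) - 1ℤ) * M + M) - (((h - 1ℤ) * M + r) - 1ℤ)
      lemma₄ = solve-∀
      -1≤j₀ : -1ℤ ≤ j₀
      -1≤j₀ = ≤-trans -≤+ (subst (0ℤ ≤_) (lemma₂ (H i) M)
                (*-monoʳ-≤-nonNeg M {{nonNegative 0≤M}} {0ℤ} {H i - 1ℤ} (≤-by-diff (lemma₃ (H i)) 1≤Hi)))
      j₀≤i-1 : j₀ ≤ i - 1ℤ
      j₀≤i-1 = ≤-by-diff (trans (lemma₄ (H i) M (R i)) (cong (λ x → j₀ - (x - 1ℤ)) (sym (H-R-decomp i))))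
                         (1≤R i)
    ... | no Hi≱1 = ≤-by-diff (trans (lemma (M) G) (cong (λ r → (M + 1ℤ - r) - G) (sym Ri≡M)))
                      (T≡M⇒1≤G (trans (sym φi≡T) (trans (cong₂ (λ h r → h * G + r) Hi≡0 Ri≡M) (+-identityˡ M))))
      where
      Hi≡0 : H i ≡ 0ℤ
      Hi≡0 = ≤-antisym (<⇒≤-1 (≰⇒> Hi≱1)) (0≤i⇒0≤H 0≤i)
      Ri≡M : R i ≡ M
      Ri≡M = 0≤i∧H≡0⇒R≡M 0≤i Hi≡0
      lemma : ∀ M G → 1ℤ - G ≡ (M + 1ℤ - M) - G
      lemma = solve-∀

module Levels (m : ℕ) where

  open Partitions
  open IntegerOrder
  open import Data.Nat as ℕ using (ℕ; suc; z≤n; s≤s)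
  import Data.Nat.Properties as ℕ
  open import Data.Integer using (+_; _+_; _-_; _*_; 0ℤ; 1ℤ; -1ℤ; _≤_; _<_; +≤+; -≤+; _/ℕ_; _%ℕ_)
  open import Data.Integer.Properties
  open import Data.Integer.DivMod using (a≡a%ℕn+[a/ℕn]*n; n%ℕd<d)
  open import Data.Integer.Tactic.RingSolver using (solve-∀)
  open import Data.Fin using (Fin; toℕ)
  import Data.Fin.Properties as Fin
  open import Data.Product using (∃-syntax; _,_)
  open import Data.Empty using (⊥-elim)
  open import Function.Bundles using (_⇔_; mk⇔; Equivalence)
  open import Relation.Binary.PropositionalEquality
  open import Relation.Nullary using (yes; no)

  open Equivalence using (to; from)

  private
    n : ℕ
    n = suc (suc m)
    M : ℤ
    M = + suc m

  hh-rr-decomp : ∀ j → j ≡ (hh n j - 1ℤ) * M + rr n j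
  hh-rr-decomp j = lemma j (hh n j) M
    where
    lemma : ∀ j h M → j ≡ (h - 1ℤ) * M + (j - (h - 1ℤ) * M)
    lemma = solve-∀

  rr≡1+ρ : ∀ j → ∃[ ρ ] ρ ℕ.≤ m × rr n j ≡ + suc ρ
  rr≡1+ρ j = (j - 1ℤ) %ℕ suc m , ℕ.≤-pred (n%ℕd<d (j - 1ℤ) (suc m)) , (begin
    j - ((q + 1ℤ) - 1ℤ) * M ≡⟨ lemma₁ j q M ⟩
    1ℤ + ((j - 1ℤ) - q * M)  ≡⟨ cong (λ x → 1ℤ + (x - q * M)) (a≡a%ℕn+[a/ℕn]*n (j - 1ℤ) (suc m)) ⟩
    1ℤ + ((+ r + q * M) - q * M) ≡⟨ lemma₂ (+ r) (q * M) ⟩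
    1ℤ + + r                ∎)
    where
    open ≡-Reasoning
    q = (j - 1ℤ) /ℕ suc m
    r = (j - 1ℤ) %ℕ suc m
    lemma₁ : ∀ j q M → j - ((q + 1ℤ) - 1ℤ) * M ≡ 1ℤ + ((j - 1ℤ) - q * M)
    lemma₁ = solve-∀
    lemma₂ : ∀ a b → 1ℤ + ((a + b) - b) ≡ 1ℤ + a
    lemma₂ = solve-∀

  1≤rr : ∀ j → 1ℤ ≤ rr n j
  1≤rr j with rr≡1+ρ j
  ... | _ , _ , eq = subst (1ℤ ≤_) (sym eq) (+≤+ (s≤s z≤n))

  rr≤M : ∀ j → rr n j ≤ M
  rr≤M j with rr≡1+ρ j
  ... | _ , ρ≤m , eq = subst (_≤ M) (sym eq) (+≤+ (s≤s ρ≤m))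

  open Blocks M (+≤+ (s≤s z≤n)) (hh n) (rr n) hh-rr-decomp 1≤rr rr≤M public

  -- WD(b) = (n − 1) − slope b.
  slope : Basis n → ℤ
  slope (k , Λ) = + toℕ k - (+ wt Λ - + deg Λ)

  lev-j≡ : ∀ j b → lev n j b - j ≡ + (degB b ℕ.+ m) - φ (slope b) j
  lev-j≡ j (k , Λ) = begin
    lev n j (k , Λ) - j                         ≡⟨ cong (λ x → lev n j (k , Λ) - x) (hh-rr-decomp j) ⟩
    lev n j (k , Λ) - ((h - 1ℤ) * M + rr n j)    ≡⟨ lemma h (rr n j) (+ toℕ k) (+ wt Λ) (+ deg Λ) (+ m) ⟩
    + (deg Λ ℕ.+ m) - φ (slope (k , Λ)) j         ∎
    where
    open ≡-Reasoning
    h = hh n j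
    lemma : ∀ h r K W D m → (h * ((W - D) + (1ℤ + (1ℤ + m)) - (1ℤ + K)) + D - 1ℤ) - ((h - 1ℤ) * (1ℤ + m) + r)
                            ≡ (D + m) - (h * (K - (W - D)) + r)
    lemma = solve-∀

  lev≤⇔ : ∀ j b → lev n j b ≤ j ⇔ + (degB b ℕ.+ m) ≤ φ (slope b) j
  lev≤⇔ j b = mk⇔ (λ lev≤j → i-j≤0⇒i≤j (subst (_≤ 0ℤ) (lev-j≡ j b) (i≤j⇒i-j≤0 lev≤j)))
                  (λ T≤φ → i-j≤0⇒i≤j (subst (_≤ 0ℤ) (sym (lev-j≡ j b)) (i≤j⇒i-j≤0 T≤φ)))

  slope≡ : ∀ (k : Fin n) (Λ : Part (toℕ k)) → slope (k , Λ) ≡ + toℕ k - + wtFrom 0 Λ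
  slope≡ k Λ = trans (cong (λ w → + toℕ k - (+ w - + deg Λ)) (wt≡deg+wtFrom0 Λ))
                     (cong (λ x → + toℕ k - x) (lemma (+ deg Λ) (+ wtFrom 0 Λ)))
    where
    lemma : ∀ d e → (d + e) - d ≡ e
    lemma = solve-∀

  slope≤M : ∀ b → slope b ≤ M
  slope≤M (k , Λ) = subst (_≤ M) (sym (slope≡ k Λ))
    (≤-trans (i-j≤i (+ toℕ k) (+ wtFrom 0 Λ)) (+≤+ (ℕ.≤-pred (Fin.toℕ<n k))))

  threshold≡M⇒1≤slope : ∀ b → + (degB b ℕ.+ m) ≡ M → 1ℤ ≤ slope b
  threshold≡M⇒1≤slope (k , Λ) T≡M =
    ≤-by-diff (trans (lemma (+ wt Λ) (+ toℕ k)) (cong (λ d → 1ℤ - (+ toℕ k - (+ wt Λ - + d))) (sym deg≡1)))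
              (+≤+ wt≤k)
    where
    deg≡1 : deg Λ ≡ 1
    deg≡1 = ℕ.+-cancelʳ-≡ m (deg Λ) 1 (+-injective T≡M)
    wt≤k : wt Λ ℕ.≤ toℕ k
    wt≤k = subst (wt Λ ℕ.≤_) (trans (cong (toℕ k ℕ.*_) deg≡1) (ℕ.*-identityʳ (toℕ k))) (wtFrom≤*deg 0 Λ)
    lemma : ∀ w k → w - k ≡ 1ℤ - (k - (w - 1ℤ))
    lemma = solve-∀

  InL⇔ : ∀ {i} → 0ℤ ≤ i → ∀ b →
         InL n i b ⇔ (φ (slope b) i ≡ + (degB b ℕ.+ m) × M + 1ℤ - rr n i ≤ slope b)
  InL⇔ {i} 0≤i b = mk⇔ forth back
    where
    G = slope b
    T = + (degB b ℕ.+ m)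
    forth : InL n i b → φ G i ≡ T × M + 1ℤ - rr n i ≤ G
    forth ((j , -1≤j , j≤i , levj≤j) , ¬N) =
      φi≡T , entry-slope-bound G 0≤i (threshold≡M⇒1≤slope b) φi≡T φ<T
      where
      T≤φi : T ≤ φ G i
      T≤φi with j ≟ i
      ... | yes refl = to (lev≤⇔ i b) levj≤j
      ... | no j≢i   = ⊥-elim (¬N (j , -1≤j , <⇒≤-1 (≤∧≢⇒< j≤i j≢i) , levj≤j))
      φ<T : ∀ j → -1ℤ ≤ j → j ≤ i - 1ℤ → φ G j < T
      φ<T j -1≤j j≤i-1 = ≰⇒> λ T≤φj → ¬N (j , -1≤j , j≤i-1 , from (lev≤⇔ j b) T≤φj)
      φi≡T : φ G i ≡ T
      φi≡T = entry-φ≡T G {i} (slope≤M b) T≤φi (φ<T (i - 1ℤ) (0≤i⇒-1≤i-1 0≤i) ≤-refl)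
    back : φ G i ≡ T × M + 1ℤ - rr n i ≤ G → InL n i b
    back (φi≡T , bound) =
      (i , ≤-trans -≤+ 0≤i , ≤-refl , from (lev≤⇔ i b) (≤-reflexive (sym φi≡T))) ,
      λ (j , _ , j≤i-1 , levj≤j) →
        <⇒≱ (subst (φ G j <_) φi≡T (φ-< G {i} bound (≤-1⇒< j≤i-1))) (to (lev≤⇔ j b) levj≤j)

module NaturalForm where

  open Cardinality
  open LevelShapes
  open IntegerOrder
  open import Data.Nat as ℕ using (ℕ; suc; z≤n; s≤s)
  import Data.Nat.Properties as ℕ
  open import Data.Integer using (-[1+_]; _+_; _*_; -_; 1ℤ; _≤_; +≤+; ∣_∣; _⊖_)
  open import Data.Integer.Properties
  open import Data.Integer.Tactic.RingSolver using (solve-∀)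
  open import Data.Product using (∃-syntax; _,_)
  open import Function.Bundles using (_⇔_; mk⇔; Equivalence)
  open import Relation.Binary.PropositionalEquality
  open import Relation.Nullary using (yes; no)

  open Equivalence using (to; from)

  level-equations⇔ : ∀ {h ρ σ d k e} {H R G T M : ℤ} →
    H ≡ + h → R ≡ + suc ρ → G ≡ + k - + e → T ≡ + (d ℕ.+ (ρ ℕ.+ σ)) → M ≡ + suc (ρ ℕ.+ σ) →
    (H * G + R ≡ T × M + 1ℤ - R ≤ G) ⇔ (∃[ g ] k ≡ e ℕ.+ g × σ ℕ.< g × d ℕ.+ σ ≡ h ℕ.* g ℕ.+ 1)
  level-equations⇔ {h} {ρ} {σ} {d} {k} {e} refl refl refl refl refl = mk⇔ forth back
    where
    G = + k - + e
    lemma₁ : ∀ ρ σ → (1ℤ + (ρ + σ)) + 1ℤ - (1ℤ + ρ) ≡ 1ℤ + σ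
    lemma₁ = solve-∀
    lemma₂ : ∀ x ρ d σ → (x + (1ℤ + ρ)) - (d + (ρ + σ)) ≡ (x + 1ℤ) - (d + σ)
    lemma₂ = solve-∀
    lemma₃ : ∀ k e → k ≡ e + (k - e)
    lemma₃ = solve-∀
    lemma₄ : ∀ e g → (e + g) - e ≡ g
    lemma₄ = solve-∀
    bound≡ : + suc (ρ ℕ.+ σ) + 1ℤ - + suc ρ ≡ + suc σ
    bound≡ = lemma₁ (+ ρ) (+ σ)
    shift : ∀ g → (+ h * + g + + suc ρ ≡ + (d ℕ.+ (ρ ℕ.+ σ))) ⇔ (d ℕ.+ σ ≡ h ℕ.* g ℕ.+ 1)
    shift g = mk⇔
      (λ eq → +-injective (sym (trans (cong (λ x → x + 1ℤ) (pos-* h g))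
                                      (≡-by-diff (lemma₂ (+ h * + g) (+ ρ) (+ d) (+ σ)) eq))))
      (λ eq → ≡-by-diff (sym (lemma₂ (+ h * + g) (+ ρ) (+ d) (+ σ)))
                        (trans (cong (λ x → x + 1ℤ) (sym (pos-* h g))) (sym (cong +_ eq))))
    forth : + h * G + + suc ρ ≡ + (d ℕ.+ (ρ ℕ.+ σ)) × + suc (ρ ℕ.+ σ) + 1ℤ - + suc ρ ≤ G →
            ∃[ g ] k ≡ e ℕ.+ g × σ ℕ.< g × d ℕ.+ σ ≡ h ℕ.* g ℕ.+ 1
    forth (eq , bound) =
      ∣ G ∣ , +-injective (trans (lemma₃ (+ k) (+ e)) (cong (λ x → + e + x) (sym G≡g))) ,
      drop‿+≤+ (subst (+ suc σ ≤_) (sym G≡g) 1+σ≤G) ,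
      to (shift ∣ G ∣) (subst (λ x → + h * x + + suc ρ ≡ + (d ℕ.+ (ρ ℕ.+ σ))) (sym G≡g) eq)
      where
      1+σ≤G : + suc σ ≤ G
      1+σ≤G = subst (_≤ G) bound≡ bound
      G≡g : + ∣ G ∣ ≡ G
      G≡g = 0≤i⇒+∣i∣≡i (≤-trans (+≤+ z≤n) 1+σ≤G)
    back : ∃[ g ] k ≡ e ℕ.+ g × σ ℕ.< g × d ℕ.+ σ ≡ h ℕ.* g ℕ.+ 1 →
           + h * G + + suc ρ ≡ + (d ℕ.+ (ρ ℕ.+ σ)) × + suc (ρ ℕ.+ σ) + 1ℤ - + suc ρ ≤ G
    back (g , refl , σ<g , deg≡) =
      subst (λ x → + h * x + + suc ρ ≡ + (d ℕ.+ (ρ ℕ.+ σ))) (sym (lemma₄ (+ e) (+ g))) (from (shift g) deg≡) ,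
      subst₂ _≤_ (sym bound≡) (sym (lemma₄ (+ e) (+ g))) (+≤+ σ<g)

  OnLevel-count-bSeq : ∀ {h σ m k} → σ ℕ.≤ m → m ℕ.≤ suc h → k ℕ.≤ suc m →
                    HasCard (OnLevel h σ {k}) (bSeq (+ k - + suc σ))
  OnLevel-count-bSeq {h} {σ} {m} {k} σ≤m m≤1+h k≤1+m with k ℕ.≤? σ
  ... | yes k≤σ = subst (HasCard (OnLevel h σ)) (sym (cong bSeq (begin
    + k - + suc σ           ≡⟨ m-n≡m⊖n k (suc σ) ⟩
    k ⊖ suc σ               ≡⟨ ⊖-< (s≤s k≤σ) ⟩
    - + (suc σ ℕ.∸ k) ≡⟨ cong (λ x → - + x) (ℕ.+-∸-assoc 1 k≤σ) ⟩
    -[1+ σ ℕ.∸ k ]          ∎))) (HasCard-∅ (OnLevel-empty {h} k≤σ))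
    where open ≡-Reasoning
  ... | no k≰σ = subst (λ k → HasCard (OnLevel h σ {k}) (bSeq (+ k - + suc σ))) (ℕ.m+[n∸m]≡n σ<k)
    (subst (HasCard (OnLevel h σ)) (sym (cong bSeq (k-σ≡ (k ℕ.∸ suc σ))))
      (OnLevel-count {h} (λ e g e+g≡ σ<g →
        σ+e≤h*g+1 {h} σ≤m m≤1+h (subst (ℕ._≤ suc m) (trans (sym (ℕ.m+[n∸m]≡n σ<k)) (sym e+g≡)) k≤1+m) σ<g)))
    where
    σ<k : suc σ ℕ.≤ k
    σ<k = ℕ.≰⇒> k≰σ
    k-σ≡ : ∀ E → + suc (σ ℕ.+ E) - + suc σ ≡ + E
    k-σ≡ E = lemma (+ σ) (+ E)
      where
      lemma : ∀ σ E → (1ℤ + (σ + E)) - (1ℤ + σ) ≡ E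
      lemma = solve-∀


module AtIndex (m : ℕ) {i : ℤ} (0≤i : ℤ.0ℤ ℤ.≤ i)
               (cap : ((+ suc (suc m)) - (+ 4)) ℤ.* ((+ suc (suc m)) - ℤ.1ℤ) ℤ.< i) where

  open Cardinality
  open LevelShapes
  open IntegerOrder
  open Levels m
  open NaturalForm
  open import Data.Nat as ℕ using (ℕ; suc; s≤s)
  import Data.Nat.Properties as ℕ
  open import Data.Integer using (_+_; _*_; 1ℤ; _<_; ∣_∣)
  open import Data.Integer.Properties
  open import Data.Integer.Tactic.RingSolver using (solve-∀)
  open import Data.Fin using (Fin; toℕ; fromℕ<)
  import Data.Fin.Properties as Fin
  open import Data.Product using (∃-syntax; _,_; proj₁; proj₂)
  open import Function.Bundles using (_⇔_; Equivalence)
  import Function.Properties.Equivalence as ⇔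
  open import Relation.Binary.PropositionalEquality

  open Equivalence using (to; from)

  private
    n : ℕ
    n = suc (suc m)
    M : ℤ
    M = + suc m

  h : ℕ
  h = ∣ hh n i ∣

  hh≡h : hh n i ≡ + h
  hh≡h = sym (0≤i⇒+∣i∣≡i (0≤i⇒0≤H 0≤i))

  ρ : ℕ
  ρ = proj₁ (rr≡1+ρ i)

  rr≡ : rr n i ≡ + suc ρ
  rr≡ = proj₂ (proj₂ (rr≡1+ρ i))

  σ : ℕ
  σ = m ℕ.∸ ρ

  m≡ρ+σ : m ≡ ρ ℕ.+ σ
  m≡ρ+σ = sym (ℕ.m+[n∸m]≡n (proj₁ (proj₂ (rr≡1+ρ i))))

  -- i ≤ h (n − 1), so the hypothesis on i says h > n − 4.
  m≤1+h : m ℕ.≤ suc h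
  m≤1+h = ℕ.≤-pred (drop‿+<+ (<-by-diff {x' = + m} {y' = + 2 + + h} (lemma₃ (+ m) (+ h))
    (*-cancelʳ-<-nonNeg {+ m - + 2} {+ h} M (begin-strict
      (+ m - + 2) * M               ≡⟨ lemma₁ (+ m) ⟩
      (+ n - + 4) * (+ n - 1ℤ)      <⟨ cap ⟩
      i                             ≡⟨ hh-rr-decomp i ⟩
      (hh n i - 1ℤ) * M + rr n i    ≤⟨ +-monoʳ-≤ ((hh n i - 1ℤ) * M) (rr≤M i) ⟩
      (hh n i - 1ℤ) * M + M         ≡⟨ lemma₂ (hh n i) M ⟩
      hh n i * M                    ≡⟨ cong (_* M) hh≡h ⟩
      + h * M                       ∎))))
    where
    open ≤-Reasoning
    lemma₁ : ∀ x → (x - + 2) * (1ℤ + x) ≡ ((1ℤ + (1ℤ + x)) - + 4) * ((1ℤ + (1ℤ + x)) - 1ℤ)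
    lemma₁ = solve-∀
    lemma₂ : ∀ h M → (h - 1ℤ) * M + M ≡ h * M
    lemma₂ = solve-∀
    lemma₃ : ∀ m h → (m - + 2) - h ≡ m - (+ 2 + h)
    lemma₃ = solve-∀

  InL⇔OnLevel : ∀ (k : Fin n) (Λ : Part (toℕ k)) → InL n i (k , Λ) ⇔ OnLevel h σ Λ
  InL⇔OnLevel k Λ = ⇔.trans (InL⇔ 0≤i (k , Λ))
    (⇔.trans (level-equations⇔ hh≡h rr≡ (slope≡ k Λ) (cong (λ x → + (deg Λ ℕ.+ x)) m≡ρ+σ)
                                (cong (λ x → + suc x) m≡ρ+σ))
             (⇔.sym (OnLevel⇔ {h} {σ} Λ)))

  card-fibre : ∀ (k : Fin n) →
                HasCard (λ b → InL n i b × kOf b ≡ suc (toℕ k)) (bSeq (+ toℕ k - + suc σ))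
  card-fibre k = HasCard-image (k ,_) (λ { refl → refl })
    (λ Λ p → from (InL⇔OnLevel k Λ) p , refl) back
    (OnLevel-count-bSeq (ℕ.m∸n≤m m ρ) m≤1+h (ℕ.≤-pred (Fin.toℕ<n k)))
    where
    back : ∀ b → InL n i b × kOf b ≡ suc (toℕ k) → ∃[ Λ ] OnLevel h σ Λ × (k , Λ) ≡ b
    back (k' , Λ) (p , k'≡k) with Fin.toℕ-injective (ℕ.suc-injective k'≡k)
    ... | refl = Λ , to (InL⇔OnLevel k Λ) p , refl

  card-fibre′ : ∀ k' → k' ℕ.< n → HasCard (λ b → InL n i b × kOf b ≡ suc k') (bSeq (+ k' - + suc σ))
  card-fibre′ k' k'<n = subst (λ k' → HasCard (λ b → InL n i b × kOf b ≡ suc k') (bSeq (+ k' - + suc σ)))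
                           (Fin.toℕ-fromℕ< k'<n) (card-fibre (fromℕ< k'<n))

  card-ℒ∩ℬ : ∀ k' → suc k' ℕ.≤ n →
            HasCard (λ b → InL n i b × kOf b ≡ suc k') (bSeq (rr n i + + suc k' - + n - 1ℤ))
  card-ℒ∩ℬ k' k'<n = subst (HasCard (λ b → InL n i b × kOf b ≡ suc k')) (cong bSeq index≡) (card-fibre′ k' k'<n)
    where
    lemma : ∀ ρ σ k → k - (1ℤ + σ) ≡ (1ℤ + ρ) + (1ℤ + k) - (1ℤ + (1ℤ + (ρ + σ))) - 1ℤ
    lemma = solve-∀
    index≡ : + k' - + suc σ ≡ rr n i + + suc k' - + n - 1ℤ
    index≡ = trans (lemma (+ ρ) (+ σ) (+ k'))
                   (cong₂ (λ r x → r + + suc k' - + suc (suc x) - 1ℤ) (sym rr≡) (sym m≡ρ+σ))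

  card-ℒ : HasCard (InL n i) (cSeq (rr n i - 1ℤ))
  card-ℒ = subst (HasCard (InL n i)) (cong cSeq (sym rr-1≡ρ))
    (subst (HasCard (InL n i)) (sym (cNat≡partialSum ρ))
      (HasCard-cong ((λ b (_ , _ , p , _) → p) , split)
        (HasCard-⋃≤ (λ (_ , k≡) (_ , k≡') → ℕ.+-cancelˡ-≡ σ _ _ (ℕ.suc-injective (ℕ.suc-injective
                                                                    (trans (sym k≡) k≡'))))
                    ρ piece)))
    where
    rr-1≡ρ : rr n i - 1ℤ ≡ + ρ
    rr-1≡ρ = trans (cong (λ r → r - 1ℤ) rr≡) (lemma (+ ρ))
      where
      lemma : ∀ ρ → (1ℤ + ρ) - 1ℤ ≡ ρ
      lemma = solve-∀
    piece : ∀ E → E ℕ.≤ ρ → HasCard (λ b → InL n i b × kOf b ≡ suc (suc (σ ℕ.+ E))) (bNat E)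
    piece E E≤ρ = subst (HasCard (λ b → InL n i b × kOf b ≡ suc (suc (σ ℕ.+ E))))
                        (cong bSeq (lemma (+ σ) (+ E)))
      (card-fibre′ (suc (σ ℕ.+ E)) (s≤s (s≤s (subst (σ ℕ.+ E ℕ.≤_) (trans (ℕ.+-comm σ ρ) (sym m≡ρ+σ))
                                                   (ℕ.+-monoʳ-≤ σ E≤ρ)))))
      where
      lemma : ∀ σ E → (1ℤ + (σ + E)) - (1ℤ + σ) ≡ E
      lemma = solve-∀
    split : ∀ b → InL n i b → ∃[ E ] E ℕ.≤ ρ × InL n i b × kOf b ≡ suc (suc (σ ℕ.+ E))
    split (k , Λ) p = E , E≤ρ , p , cong suc (sym (ℕ.m+[n∸m]≡n σ<k))
      where
      σ<k : σ ℕ.< toℕ k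
      σ<k = OnLevel⇒σ<k {h} {Λ = Λ} (to (InL⇔OnLevel k Λ) p)
      E = toℕ k ℕ.∸ suc σ
      E≤ρ : E ℕ.≤ ρ
      E≤ρ = ℕ.+-cancelˡ-≤ (suc σ) E ρ (begin
        suc σ ℕ.+ E   ≡⟨ ℕ.m+[n∸m]≡n σ<k ⟩
        toℕ k         ≤⟨ ℕ.≤-pred (Fin.toℕ<n k) ⟩
        suc m         ≡⟨ cong suc (trans m≡ρ+σ (ℕ.+-comm ρ σ)) ⟩
        suc σ ℕ.+ ρ   ∎)
        where open ℕ.≤-Reasoning

corollary2p16 : (n : ℕ) → 2 ℕ.≤ n → (i : ℤ) → ℤ.0ℤ ℤ.≤ i →
    ((+ n) - (+ 4)) ℤ.* ((+ n) - ℤ.1ℤ) ℤ.< i →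
    ((k : ℕ) → 1 ℕ.≤ k → k ℕ.≤ n →
      HasCard (λ (b : Basis n) → InL n i b × kOf b ≡ k)
        (bSeq (rr n i ℤ.+ (+ k) - (+ n) - ℤ.1ℤ)))
    × HasCard (InL n i) (cSeq (rr n i - ℤ.1ℤ))
corollary2p16 (suc (suc m)) (s≤s (s≤s z≤n)) i 0≤i cap = (λ { (suc k') _ → card-ℒ∩ℬ k' }) , card-ℒ
  where open AtIndex m 0≤i cap
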